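{- Let $G$ be a simple bipartite graph with partite sets of sizes $n_1$ and $n_2$, no isolated vertices, and exactly $\alpha n_1 n_2$ edges for some $\alpha\in(0,1]$. Then for every positive integer $s$, \[ \alpha^{s^2}(n_1n_2)^s \leq \hom(K_{s,s},G) \leq (2\alpha)^s (n_1n_2)^s. \]
   Context: A homomorphism from a graph $T$ to a graph $G$ is a map $\sigma:V(T)\to V(G)$ such that $\{u,v\}\in E(T)$ implies $\{\sigma(u),\sigma(v)\}\in E(G)$; $\hom(T,G)$ denotes the number of such homomorphisms. $K_{s,s}$ is the complete bipartite graph with both partite sets of size $s$. -}

module Defs where

open import Data.Bool using (Bool; true; false; _∧_)
open import Data.Nat using (ℕ; zero; suc; _+_)
open import Data.Fin using (Fin; zero; suc; splitAt)
open import Data.Fin.Properties using ()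
open import Data.List using (List; []; _∷_; map; concatMap; length; filterᵇ; allFin)
open import Data.Product using (_×_; _,_; ∃)
open import Data.Sum using (_⊎_; inj₁; inj₂)
open import Data.Integer using (+_)
open import Data.Rational using (ℚ; _/_; _*_; 1ℚ)
open import Relation.Binary.PropositionalEquality using (_≡_; refl)

record Graph : Set where
  field
    n     : ℕ
    adj   : Fin n → Fin n → Bool
    sym   : ∀ u v → adj u v ≡ adj v u
    loopless : ∀ u → adj u u ≡ false
open Graph public

cons : ∀ {A : Set} {k} → A → (Fin k → A) → Fin (suc k) → A
cons a f zero    = a
cons a f (suc i) = f i

allFuns : ∀ {A : Set} → List A → (k : ℕ) → List (Fin k → A)
allFuns xs zero    = (λ ()) ∷ []
allFuns xs (suc k) = concatMap (λ a → map (cons a) (allFuns xs k)) xs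

allᵇ : ∀ {A : Set} → (A → Bool) → List A → Bool
allᵇ p []       = true
allᵇ p (x ∷ xs) = p x ∧ allᵇ p xs

isHomᵇ : (T G : Graph) → (Fin (n T) → Fin (n G)) → Bool
isHomᵇ T G σ =
  allᵇ (λ u → allᵇ (λ v → implies (adj T u v) (adj G (σ u) (σ v))) (allFin (n T))) (allFin (n T))
  where
  implies : Bool → Bool → Bool
  implies false _ = true
  implies true  b = b

hom : Graph → Graph → ℕ
hom T G = length (filterᵇ (isHomᵇ T G) (allFuns (allFin (n G)) (n T)))

NoIsolated : Graph → Set
NoIsolated G = ∀ u → ∃ λ v → adj G u v ≡ true

-- Bipartite graphs with partite sets Fin n₁ and Fin n₂ (vertex set Fin (n₁ + n₂),
-- first n₁ vertices form the first part), given by a relation R between the parts.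
badj : ∀ {n₁ n₂} → (Fin n₁ → Fin n₂ → Bool) → Fin n₁ ⊎ Fin n₂ → Fin n₁ ⊎ Fin n₂ → Bool
badj R (inj₁ i) (inj₂ j) = R i j
badj R (inj₂ j) (inj₁ i) = R i j
badj R (inj₁ _) (inj₁ _) = false
badj R (inj₂ _) (inj₂ _) = false

badj-sym : ∀ {n₁ n₂} (R : Fin n₁ → Fin n₂ → Bool) x y → badj R x y ≡ badj R y x
badj-sym R (inj₁ i) (inj₂ j) = refl
badj-sym R (inj₂ j) (inj₁ i) = refl
badj-sym R (inj₁ _) (inj₁ _) = refl
badj-sym R (inj₂ _) (inj₂ _) = refl

badj-irr : ∀ {n₁ n₂} (R : Fin n₁ → Fin n₂ → Bool) x → badj R x x ≡ false
badj-irr R (inj₁ _) = refl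
badj-irr R (inj₂ _) = refl

bipartite : (n₁ n₂ : ℕ) → (Fin n₁ → Fin n₂ → Bool) → Graph
bipartite n₁ n₂ R = record
  { n = n₁ + n₂
  ; adj = λ u v → badj R (splitAt n₁ u) (splitAt n₁ v)
  ; sym = λ u v → badj-sym R (splitAt n₁ u) (splitAt n₁ v)
  ; loopless = λ u → badj-irr R (splitAt n₁ u)
  }

bipEdges : ∀ {n₁ n₂} → (Fin n₁ → Fin n₂ → Bool) → ℕ
bipEdges {n₁} {n₂} R =
  length (filterᵇ (λ p → R (Data.Product.proj₁ p) (Data.Product.proj₂ p))
    (concatMap (λ i → map (λ j → (i , j)) (allFin n₂)) (allFin n₁)))

K : ℕ → Graph
K s = bipartite s s (λ _ _ → true)

ℕ→ℚ : ℕ → ℚ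
ℕ→ℚ m = + m / 1

infixr 8 _^ℚ_
_^ℚ_ : ℚ → ℕ → ℚ
q ^ℚ zero  = 1ℚ
q ^ℚ suc k = q * (q ^ℚ k)

module Submission where

-- A homomorphism K_{s,s} → G is a pair of s-tuples (f, g) of vertices with every f i
-- adjacent to every g j. Keeping only the s conditions f i ~ g i bounds hom by the number
-- of s-tuples of ordered edges, (2e)^s. For the lower bound keep only the homomorphisms
-- sending the two sides into the two parts: there are ∑_b c(b)^s of them, c(b) being the
-- number of common neighbours of an s-tuple b of the second part. The power-mean inequality
-- (∑ w)^s ≤ N^(s-1) ∑ w^s, a consequence of Chebyshev's sum inequality, applied to the
-- degrees and then to c gives e^s ≤ n₁^(s-1) ∑_x d(x)^s = n₁^(s-1) ∑_b c(b) and
-- (∑_b c(b))^s ≤ n₂^(s(s-1)) ∑_b c(b)^s, so e^(s²) ≤ (n₁n₂)^(s(s-1)) hom; now substitute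
-- e = α n₁ n₂.

open import Defs hiding (sym)

module Counting where
  open import Data.Bool using (Bool; true; false)
  open import Data.Nat using (ℕ; zero; suc; _+_; _*_; _^_; _≤_; _<_; z≤n; s≤s; >-nonZero; >-nonZero⁻¹)
  open import Data.Nat.Properties
  open import Data.Nat.Tactic.RingSolver using (solve-∀)
  open import Data.Fin using (Fin; zero; suc; _↑ˡ_; _↑ʳ_; splitAt)
  open import Data.Fin.Properties using (splitAt-↑ˡ; splitAt-↑ʳ)
  open import Data.List as List using (List; []; _∷_; map; concatMap; length; filterᵇ; allFin; tabulate)
  open import Data.List.Properties using (length-tabulate)
  open import Data.Sum using (inj₁; inj₂)
  open import Data.Product using (_,_; ∃; proj₁; proj₂)
  open import Data.List.Membership.Propositional using (_∈_)
  open import Data.List.Membership.Propositional.Properties using (∈-allFin)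
  open import Data.List.Relation.Unary.Any using (here; there)
  open import Relation.Nullary using (contradiction)
  open import Data.Vec.Functional using (_++_)
  open import Data.Vec.Functional.Properties using (lookup-++ˡ; lookup-++ʳ; ++-cong)
  open import Data.Bool.Properties using (⇔→≡)
  open import Function using (_∘_; id; mk⇔)
  open import Relation.Binary.PropositionalEquality

  private variable
    A C : Set

  ∑ : List A → (A → ℕ) → ℕ
  ∑ []       h = 0
  ∑ (x ∷ xs) h = h x + ∑ xs h

  -- ∑[ x ∈ xs ] binds tighter than the arithmetic operators: a body built with an operator is parenthesised.
  syntax ∑ xs (λ x → e) = ∑[ x ∈ xs ] e

  ⟦_⟧ : Bool → ℕ
  ⟦ true  ⟧ = 1
  ⟦ false ⟧ = 0

  module _ where
    open ≡-Reasoning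

    ∑-cong : (xs : List A) {h h′ : A → ℕ} → h ≗ h′ → ∑ xs h ≡ ∑ xs h′
    ∑-cong []       e = refl
    ∑-cong (x ∷ xs) e = cong₂ _+_ (e x) (∑-cong xs e)

    ∑-mono-≤ : (xs : List A) {h h′ : A → ℕ} → (∀ x → h x ≤ h′ x) → ∑ xs h ≤ ∑ xs h′
    ∑-mono-≤ []       e = z≤n
    ∑-mono-≤ (x ∷ xs) e = +-mono-≤ (e x) (∑-mono-≤ xs e)

    ∑-++ : (xs ys : List A) (h : A → ℕ) → ∑ (xs List.++ ys) h ≡ ∑ xs h + ∑ ys h
    ∑-++ []       ys h = refl
    ∑-++ (x ∷ xs) ys h = trans (cong (h x +_) (∑-++ xs ys h)) (sym (+-assoc (h x) _ _))

    ∑-map : (g : C → A) (xs : List C) (h : A → ℕ) → ∑ (map g xs) h ≡ ∑[ x ∈ xs ] h (g x)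
    ∑-map g []       h = refl
    ∑-map g (x ∷ xs) h = cong (h (g x) +_) (∑-map g xs h)

    ∑-concatMap : (g : C → List A) (xs : List C) (h : A → ℕ) →
      ∑ (concatMap g xs) h ≡ ∑[ x ∈ xs ] ∑ (g x) h
    ∑-concatMap g []       h = refl
    ∑-concatMap g (x ∷ xs) h = trans (∑-++ (g x) (concatMap g xs) h) (cong (∑ (g x) h +_) (∑-concatMap g xs h))

    ∑-distrib-+ : (xs : List A) (h g : A → ℕ) → ∑[ x ∈ xs ] (h x + g x) ≡ ∑ xs h + ∑ xs g
    ∑-distrib-+ []       h g = refl
    ∑-distrib-+ (x ∷ xs) h g = trans (cong (h x + g x +_) (∑-distrib-+ xs h g)) (+-interchange (h x) (g x) _ _)
      where
      +-interchange : ∀ a b c d → (a + b) + (c + d) ≡ (a + c) + (b + d)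
      +-interchange = solve-∀

    ∑-*ˡ : (xs : List A) (c : ℕ) (h : A → ℕ) → ∑[ x ∈ xs ] (c * h x) ≡ c * ∑ xs h
    ∑-*ˡ []       c h = sym (*-zeroʳ c)
    ∑-*ˡ (x ∷ xs) c h = trans (cong (c * h x +_) (∑-*ˡ xs c h)) (sym (*-distribˡ-+ c (h x) _))

    ∑-*ʳ : (xs : List A) (c : ℕ) (h : A → ℕ) → ∑[ x ∈ xs ] (h x * c) ≡ ∑ xs h * c
    ∑-*ʳ xs c h = trans (∑-cong xs (λ x → *-comm (h x) c)) (trans (∑-*ˡ xs c h) (*-comm c _))

    ∑-const : (xs : List A) (c : ℕ) → ∑[ x ∈ xs ] c ≡ length xs * c
    ∑-const []       c = refl
    ∑-const (x ∷ xs) c = cong (c +_) (∑-const xs c)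

    ∑-zero : (xs : List A) → ∑[ x ∈ xs ] 0 ≡ 0
    ∑-zero xs = trans (∑-const xs 0) (*-zeroʳ (length xs))

    ∑-comm : (xs : List A) (ys : List C) (h : A → C → ℕ) →
      ∑[ x ∈ xs ] ∑[ y ∈ ys ] h x y ≡ ∑[ y ∈ ys ] ∑[ x ∈ xs ] h x y
    ∑-comm []       ys h = sym (∑-zero ys)
    ∑-comm (x ∷ xs) ys h = begin
      ∑ ys (h x) + ∑[ x′ ∈ xs ] ∑[ y ∈ ys ] h x′ y ≡⟨ cong (∑ ys (h x) +_) (∑-comm xs ys h) ⟩
      ∑ ys (h x) + ∑[ y ∈ ys ] ∑[ x′ ∈ xs ] h x′ y ≡⟨ ∑-distrib-+ ys (h x) _ ⟨
      ∑[ y ∈ ys ] (h x y + ∑[ x′ ∈ xs ] h x′ y)    ∎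

    length-filterᵇ : (p : A → Bool) (xs : List A) → length (filterᵇ p xs) ≡ ∑[ x ∈ xs ] ⟦ p x ⟧
    length-filterᵇ p []       = refl
    length-filterᵇ p (x ∷ xs) with p x
    ... | true  = cong suc (length-filterᵇ p xs)
    ... | false = length-filterᵇ p xs

    ∑-tabulate : ∀ k (f : Fin k → A) (h : A → ℕ) → ∑ (tabulate f) h ≡ ∑[ i ∈ allFin k ] h (f i)
    ∑-tabulate zero    f h = refl
    ∑-tabulate (suc k) f h =
      cong (h (f zero) +_) (trans (∑-tabulate k (f ∘ suc) h) (sym (∑-tabulate k suc (h ∘ f))))

    ∑-allFin-+ : ∀ m n (h : Fin (m + n) → ℕ) →
      ∑ (allFin (m + n)) h ≡ ∑[ i ∈ allFin m ] h (i ↑ˡ n) + ∑[ j ∈ allFin n ] h (m ↑ʳ j)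
    ∑-allFin-+ zero    n h = refl
    ∑-allFin-+ (suc m) n h = begin
      h zero + ∑ (tabulate suc) h
        ≡⟨ cong (h zero +_) (∑-tabulate (m + n) suc h) ⟩
      h zero + ∑[ u ∈ allFin (m + n) ] h (suc u)
        ≡⟨ cong (h zero +_) (∑-allFin-+ m n (h ∘ suc)) ⟩
      h zero + (∑[ i ∈ allFin m ] h (suc i ↑ˡ n) + ∑[ j ∈ allFin n ] h (suc m ↑ʳ j))
        ≡⟨ +-assoc (h zero) _ _ ⟨
      h zero + ∑[ i ∈ allFin m ] h (suc i ↑ˡ n) + ∑[ j ∈ allFin n ] h (suc m ↑ʳ j)
        ≡⟨ cong (λ z → h zero + z + ∑[ j ∈ allFin n ] h (suc m ↑ʳ j)) (∑-tabulate m suc (λ i → h (i ↑ˡ n))) ⟨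
      ∑[ i ∈ allFin (suc m) ] h (i ↑ˡ n) + ∑[ j ∈ allFin n ] h (suc m ↑ʳ j) ∎

  ∏ : ∀ k → (Fin k → ℕ) → ℕ
  ∏ zero    g = 1
  ∏ (suc k) g = g zero * ∏ k (g ∘ suc)

  syntax ∏ k (λ i → e) = ∏[ i < k ] e

  ∏-1 : ∀ k → ∏[ i < k ] 1 ≡ 1
  ∏-1 zero    = refl
  ∏-1 (suc k) = cong (_+ 0) (∏-1 k)

  ∏-pos : ∀ k {g : Fin k → ℕ} → (∀ i → 0 < g i) → 0 < ∏ k g
  ∏-pos zero    pos = s≤s z≤n
  ∏-pos (suc k) pos = *-mono-< (pos zero) (∏-pos k (pos ∘ suc))

  ∏-pos⁻ : ∀ k {g : Fin k → ℕ} → 0 < ∏ k g → ∀ i → 0 < g i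
  ∏-pos⁻ (suc k) {g} pos zero    = >-nonZero⁻¹ (g zero) {{m*n≢0⇒m≢0 (g zero) {{>-nonZero pos}}}}
  ∏-pos⁻ (suc k) {g} pos (suc i) =
    ∏-pos⁻ k (>-nonZero⁻¹ (∏ k (g ∘ suc)) {{m*n≢0⇒n≢0 (g zero) {{>-nonZero pos}}}}) i

  ∏-≤1 : ∀ k {g : Fin k → ℕ} → (∀ i → g i ≤ 1) → ∏ k g ≤ 1
  ∏-≤1 zero    le = ≤-refl
  ∏-≤1 (suc k) le = *-mono-≤ (le zero) (∏-≤1 k (le ∘ suc))

  ⟦⟧≤1 : ∀ b → ⟦ b ⟧ ≤ 1
  ⟦⟧≤1 true  = ≤-refl
  ⟦⟧≤1 false = z≤n

  ⟦⟧-pos : ∀ {b} → b ≡ true → 0 < ⟦ b ⟧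
  ⟦⟧-pos refl = s≤s z≤n

  ⟦⟧-pos⁻ : ∀ {b} → 0 < ⟦ b ⟧ → b ≡ true
  ⟦⟧-pos⁻ {true} _ = refl

  ⟦⟧-≤ : ∀ b {y} → (b ≡ true → 0 < y) → ⟦ b ⟧ ≤ y
  ⟦⟧-≤ true  pos = pos refl
  ⟦⟧-≤ false pos = z≤n

  ≤-⟦⟧ : ∀ {x} b → x ≤ 1 → (0 < x → b ≡ true) → x ≤ ⟦ b ⟧
  ≤-⟦⟧ true  x≤1 _   = x≤1
  ≤-⟦⟧ {zero}  false _ _   = z≤n
  ≤-⟦⟧ {suc x} false _ pos with pos (s≤s z≤n)
  ... | ()

  ∑-length : (xs : List A) → ∑[ x ∈ xs ] 1 ≡ length xs
  ∑-length xs = trans (∑-const xs 1) (*-identityʳ (length xs))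

  -- Without function extensionality, a weight on functions must be shown to respect ≗.
  Respects≗ : ∀ {k} → ((Fin k → A) → ℕ) → Set
  Respects≗ w = ∀ {f g} → f ≗ g → w f ≡ w g

  cons-cong : ∀ {k} (a : A) {f g : Fin k → A} → f ≗ g → cons a f ≗ cons a g
  cons-cong a eq zero    = refl
  cons-cong a eq (suc i) = eq i

  module _ (xs : List A) where

    ∑-allFuns-suc : ∀ k (w : (Fin (suc k) → A) → ℕ) →
      ∑ (allFuns xs (suc k)) w ≡ ∑[ a ∈ xs ] ∑[ f ∈ allFuns xs k ] w (cons a f)
    ∑-allFuns-suc k w =
      trans (∑-concatMap _ xs w) (∑-cong xs (λ a → ∑-map (cons a) (allFuns xs k) w))

    ∑-allFuns-∏ : ∀ k (h : A → ℕ) → ∑[ f ∈ allFuns xs k ] ∏[ i < k ] h (f i) ≡ ∑ xs h ^ k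
    ∑-allFuns-∏ zero    h = refl
    ∑-allFuns-∏ (suc k) h = begin
      ∑[ f ∈ allFuns xs (suc k) ] ∏[ i < suc k ] h (f i)
        ≡⟨ ∑-allFuns-suc k _ ⟩
      ∑[ a ∈ xs ] ∑[ f ∈ allFuns xs k ] (h a * ∏[ i < k ] h (f i))
        ≡⟨ ∑-cong xs (λ a → ∑-*ˡ (allFuns xs k) (h a) _) ⟩
      ∑[ a ∈ xs ] (h a * ∑[ f ∈ allFuns xs k ] ∏[ i < k ] h (f i))
        ≡⟨ ∑-cong xs (λ a → cong (h a *_) (∑-allFuns-∏ k h)) ⟩
      ∑[ a ∈ xs ] (h a * ∑ xs h ^ k)
        ≡⟨ ∑-*ʳ xs _ h ⟩
      ∑ xs h ^ suc k ∎
      where open ≡-Reasoning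

    length-allFuns : ∀ k → length (allFuns xs k) ≡ length xs ^ k
    length-allFuns k = begin
      length (allFuns xs k)                   ≡⟨ ∑-length (allFuns xs k) ⟨
      ∑[ f ∈ allFuns xs k ] 1                 ≡⟨ ∑-cong (allFuns xs k) (λ _ → ∏-1 k) ⟨
      ∑[ f ∈ allFuns xs k ] ∏[ i < k ] 1      ≡⟨ ∑-allFuns-∏ k (λ _ → 1) ⟩
      (∑[ x ∈ xs ] 1) ^ k                     ≡⟨ cong (_^ k) (∑-length xs) ⟩
      length xs ^ k                           ∎
      where open ≡-Reasoning

    ∑-allFuns²-∏ : ∀ k (W : A → A → ℕ) →
      ∑[ f ∈ allFuns xs k ] ∑[ g ∈ allFuns xs k ] ∏[ i < k ] W (f i) (g i)
        ≡ (∑[ x ∈ xs ] ∑[ y ∈ xs ] W x y) ^ k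
    ∑-allFuns²-∏ zero    W = refl
    ∑-allFuns²-∏ (suc k) W = begin
      ∑[ f ∈ allFuns xs (suc k) ] ∑[ g ∈ allFuns xs (suc k) ] ∏[ i < suc k ] W (f i) (g i)
        ≡⟨ ∑-allFuns-suc k _ ⟩
      ∑[ x ∈ xs ] ∑[ f ∈ Fs ] ∑[ g ∈ allFuns xs (suc k) ] ∏[ i < suc k ] W (cons x f i) (g i)
        ≡⟨ ∑-cong xs (λ x → ∑-cong Fs (λ f → ∑-allFuns-suc k _)) ⟩
      ∑[ x ∈ xs ] ∑[ f ∈ Fs ] ∑[ y ∈ xs ] ∑[ g ∈ Fs ] (W x y * P f g)
        ≡⟨ ∑-cong xs (λ x → ∑-comm Fs xs _) ⟩
      ∑[ x ∈ xs ] ∑[ y ∈ xs ] ∑[ f ∈ Fs ] ∑[ g ∈ Fs ] (W x y * P f g)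
        ≡⟨ ∑-cong xs (λ x → ∑-cong xs (λ y → pull (W x y))) ⟩
      ∑[ x ∈ xs ] ∑[ y ∈ xs ] (W x y * (∑[ x′ ∈ xs ] ∑[ y′ ∈ xs ] W x′ y′) ^ k)
        ≡⟨ ∑-cong xs (λ x → ∑-*ʳ xs _ (W x)) ⟩
      ∑[ x ∈ xs ] ((∑[ y ∈ xs ] W x y) * (∑[ x′ ∈ xs ] ∑[ y′ ∈ xs ] W x′ y′) ^ k)
        ≡⟨ ∑-*ʳ xs _ _ ⟩
      (∑[ x ∈ xs ] ∑[ y ∈ xs ] W x y) ^ suc k ∎
      where
      open ≡-Reasoning
      Fs = allFuns xs k
      P : (Fin k → A) → (Fin k → A) → ℕ
      P f g = ∏[ i < k ] W (f i) (g i)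
      pull : ∀ c → ∑[ f ∈ Fs ] ∑[ g ∈ Fs ] (c * P f g) ≡ c * (∑[ x ∈ xs ] ∑[ y ∈ xs ] W x y) ^ k
      pull c = begin
        ∑[ f ∈ Fs ] ∑[ g ∈ Fs ] (c * P f g)  ≡⟨ ∑-cong Fs (λ f → ∑-*ˡ Fs c (P f)) ⟩
        ∑[ f ∈ Fs ] (c * ∑ Fs (P f))         ≡⟨ ∑-*ˡ Fs c _ ⟩
        c * ∑[ f ∈ Fs ] ∑ Fs (P f)           ≡⟨ cong (c *_) (∑-allFuns²-∏ k W) ⟩
        c * (∑[ x ∈ xs ] ∑[ y ∈ xs ] W x y) ^ k ∎

    ∑-allFuns-++ : ∀ s t (w : (Fin (s + t) → A) → ℕ) → Respects≗ w →
      ∑ (allFuns xs (s + t)) w ≡ ∑[ f ∈ allFuns xs s ] ∑[ g ∈ allFuns xs t ] w (f ++ g)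
    ∑-allFuns-++ zero    t w resp = sym (+-identityʳ _)
    ∑-allFuns-++ (suc s) t w resp = begin
      ∑ (allFuns xs (suc s + t)) w
        ≡⟨ ∑-allFuns-suc (s + t) w ⟩
      ∑[ a ∈ xs ] ∑ (allFuns xs (s + t)) (w ∘ cons a)
        ≡⟨ ∑-cong xs (λ a → ∑-allFuns-++ s t (w ∘ cons a) (resp ∘ cons-cong a)) ⟩
      ∑[ a ∈ xs ] ∑[ f ∈ allFuns xs s ] ∑[ g ∈ allFuns xs t ] w (cons a (f ++ g))
        ≡⟨ ∑-cong xs (λ a → ∑-cong (allFuns xs s) (λ f → ∑-cong (allFuns xs t) (λ g → resp (cons-++ a f g)))) ⟩
      ∑[ a ∈ xs ] ∑[ f ∈ allFuns xs s ] ∑[ g ∈ allFuns xs t ] w (cons a f ++ g)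
        ≡⟨ ∑-allFuns-suc s _ ⟨
      ∑[ f ∈ allFuns xs (suc s) ] ∑[ g ∈ allFuns xs t ] w (f ++ g) ∎
      where
      open ≡-Reasoning
      cons-++ : ∀ a (f : Fin s → A) (g : Fin t → A) → cons a (f ++ g) ≗ cons a f ++ g
      cons-++ a f g zero = refl
      cons-++ a f g (suc i) with splitAt s i
      ... | inj₁ _ = refl
      ... | inj₂ _ = refl

  ∑-allFuns-∘-≤ : (xs : List A) (ys : List C) (φ : C → A) → (∀ h → ∑[ y ∈ ys ] h (φ y) ≤ ∑ xs h) →
    ∀ k (w : (Fin k → A) → ℕ) → Respects≗ w →
    ∑[ f ∈ allFuns ys k ] w (φ ∘ f) ≤ ∑ (allFuns xs k) w
  ∑-allFuns-∘-≤ xs ys φ sub zero    w resp = ≤-reflexive (cong (_+ 0) (resp (λ ())))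
  ∑-allFuns-∘-≤ xs ys φ sub (suc k) w resp = begin
    ∑[ f ∈ allFuns ys (suc k) ] w (φ ∘ f)
      ≡⟨ ∑-allFuns-suc ys k _ ⟩
    ∑[ y ∈ ys ] ∑[ f ∈ allFuns ys k ] w (φ ∘ cons y f)
      ≡⟨ ∑-cong ys (λ y → ∑-cong (allFuns ys k) (λ f → resp (λ { zero → refl ; (suc i) → refl }))) ⟩
    ∑[ y ∈ ys ] ∑[ f ∈ allFuns ys k ] w (cons (φ y) (φ ∘ f))
      ≤⟨ ∑-mono-≤ ys (λ y → ∑-allFuns-∘-≤ xs ys φ sub k (w ∘ cons (φ y)) (resp ∘ cons-cong (φ y))) ⟩
    ∑[ y ∈ ys ] ∑ (allFuns xs k) (w ∘ cons (φ y))
      ≤⟨ sub (λ a → ∑ (allFuns xs k) (w ∘ cons a)) ⟩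
    ∑[ a ∈ xs ] ∑ (allFuns xs k) (w ∘ cons a)
      ≡⟨ ∑-allFuns-suc xs k w ⟨
    ∑ (allFuns xs (suc k)) w ∎
    where open ≤-Reasoning

  -- Writing y = x + d and v = u + e, the right-hand side exceeds the left by d * e.
  rearrangement : ∀ {x y u v} → x ≤ y → u ≤ v → x * v + y * u ≤ x * u + y * v
  rearrangement {x} {u = u} x≤y u≤v with m≤n⇒∃[o]m+o≡n x≤y | m≤n⇒∃[o]m+o≡n u≤v
  ... | d , refl | e , refl =
    subst (x * (u + e) + (x + d) * u ≤_) (excess x d u e) (m≤m+n _ (d * e))
    where
    excess : ∀ x d u e → x * (u + e) + (x + d) * u + d * e ≡ x * u + (x + d) * (u + e)
    excess = solve-∀

  similarlyOrdered-^ : ∀ k a b → a * b ^ k + b * a ^ k ≤ a * a ^ k + b * b ^ k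
  similarlyOrdered-^ k a b with ≤-total a b
  ... | inj₁ a≤b = rearrangement a≤b (^-monoˡ-≤ k a≤b)
  ... | inj₂ b≤a = subst₂ _≤_ (+-comm (b * a ^ k) _) (+-comm (b * b ^ k) _)
                     (rearrangement b≤a (^-monoˡ-≤ k b≤a))

  chebyshev : {A : Set} (xs : List A) (a b : A → ℕ) →
    (∀ x y → a x * b y + a y * b x ≤ a x * b x + a y * b y) →
    ∑ xs a * ∑ xs b ≤ length xs * ∑[ x ∈ xs ] (a x * b x)
  chebyshev {A} xs a b ordered = *-cancelˡ-≤ 2 (begin
    2 * (∑ xs a * ∑ xs b)
      ≡⟨ cong (2 *_) products ⟨
    2 * (∑[ x ∈ xs ] ∑[ y ∈ xs ] (a x * b y))
      ≡⟨ symmetrise (λ x y → a x * b y) ⟩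
    ∑[ x ∈ xs ] ∑[ y ∈ xs ] (a x * b y + a y * b x)
      ≤⟨ ∑-mono-≤ xs (λ x → ∑-mono-≤ xs (ordered x)) ⟩
    ∑[ x ∈ xs ] ∑[ y ∈ xs ] (a x * b x + a y * b y)
      ≡⟨ symmetrise (λ x y → a x * b x) ⟨
    2 * (∑[ x ∈ xs ] ∑[ y ∈ xs ] (a x * b x))
      ≡⟨ cong (2 *_) (∑-cong xs (λ x → ∑-const xs (a x * b x))) ⟩
    2 * (∑[ x ∈ xs ] (length xs * (a x * b x)))
      ≡⟨ cong (2 *_) (∑-*ˡ xs (length xs) _) ⟩
    2 * (length xs * ∑[ x ∈ xs ] (a x * b x)) ∎)
    where
    open ≤-Reasoning
    products : ∑[ x ∈ xs ] ∑[ y ∈ xs ] (a x * b y) ≡ ∑ xs a * ∑ xs b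
    products = trans (∑-cong xs (λ x → ∑-*ˡ xs (a x) b)) (∑-*ʳ xs (∑ xs b) a)
    symmetrise : (h : A → A → ℕ) →
      2 * (∑[ x ∈ xs ] ∑[ y ∈ xs ] h x y) ≡ ∑[ x ∈ xs ] ∑[ y ∈ xs ] (h x y + h y x)
    symmetrise h = begin-equality
      2 * (∑[ x ∈ xs ] ∑[ y ∈ xs ] h x y)
        ≡⟨ cong (∑[ x ∈ xs ] ∑[ y ∈ xs ] h x y +_) (+-identityʳ _) ⟩
      (∑[ x ∈ xs ] ∑[ y ∈ xs ] h x y) + (∑[ x ∈ xs ] ∑[ y ∈ xs ] h x y)
        ≡⟨ cong (∑[ x ∈ xs ] ∑[ y ∈ xs ] h x y +_) (∑-comm xs xs h) ⟩
      (∑[ x ∈ xs ] ∑[ y ∈ xs ] h x y) + (∑[ y ∈ xs ] ∑[ x ∈ xs ] h x y)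
        ≡⟨ ∑-distrib-+ xs _ _ ⟨
      ∑[ x ∈ xs ] ((∑[ y ∈ xs ] h x y) + (∑[ y ∈ xs ] h y x))
        ≡⟨ ∑-cong xs (λ x → ∑-distrib-+ xs _ _) ⟨
      ∑[ x ∈ xs ] ∑[ y ∈ xs ] (h x y + h y x) ∎

  power-mean : (xs : List A) (w : A → ℕ) (t : ℕ) →
    ∑ xs w ^ suc t ≤ length xs ^ t * ∑[ x ∈ xs ] (w x ^ suc t)
  power-mean xs w zero = ≤-reflexive (begin
    ∑ xs w * 1                 ≡⟨ *-identityʳ _ ⟩
    ∑ xs w                     ≡⟨ ∑-cong xs (λ x → *-identityʳ (w x)) ⟨
    ∑[ x ∈ xs ] (w x ^ 1)        ≡⟨ +-identityʳ _ ⟨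
    1 * ∑[ x ∈ xs ] (w x ^ 1)    ∎)
    where open ≡-Reasoning
  power-mean xs w (suc t) = begin
    ∑ xs w * ∑ xs w ^ suc t
      ≤⟨ *-monoʳ-≤ (∑ xs w) (power-mean xs w t) ⟩
    ∑ xs w * (N ^ t * ∑[ x ∈ xs ] (w x ^ suc t))
      ≡⟨ x*[y*z]≡y*[x*z] (∑ xs w) (N ^ t) _ ⟩
    N ^ t * (∑ xs w * ∑[ x ∈ xs ] (w x ^ suc t))
      ≤⟨ *-monoʳ-≤ (N ^ t) (chebyshev xs w (λ x → w x ^ suc t) (λ x y → similarlyOrdered-^ (suc t) (w x) (w y))) ⟩
    N ^ t * (N * ∑[ x ∈ xs ] (w x ^ suc (suc t)))
      ≡⟨ x*[y*z]≡y*[x*z] (N ^ t) N _ ⟩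
    N * (N ^ t * ∑[ x ∈ xs ] (w x ^ suc (suc t)))
      ≡⟨ *-assoc N (N ^ t) _ ⟨
    N ^ suc t * ∑[ x ∈ xs ] (w x ^ suc (suc t)) ∎
    where
    open ≤-Reasoning
    N : ℕ
    N = length xs
    x*[y*z]≡y*[x*z] : ∀ x y z → x * (y * z) ≡ y * (x * z)
    x*[y*z]≡y*[x*z] = solve-∀

  allᵇ-true⁻ : (p : A → Bool) (xs : List A) {x : A} → allᵇ p xs ≡ true → x ∈ xs → p x ≡ true
  allᵇ-true⁻ p (y ∷ xs) all (here refl) with p y
  ... | true = refl
  allᵇ-true⁻ p (y ∷ xs) all (there x∈xs) with p y
  ... | true = allᵇ-true⁻ p xs all x∈xs

  allᵇ-false⁻ : (p : A → Bool) (xs : List A) → allᵇ p xs ≡ false → ∃ λ x → p x ≡ false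
  allᵇ-false⁻ p (x ∷ xs) all with p x in px
  ... | true  = allᵇ-false⁻ p xs all
  ... | false = x , px

  IsHom : (T G : Graph) → (Fin (n T) → Fin (n G)) → Set
  IsHom T G σ = ∀ u v → adj T u v ≡ true → adj G (σ u) (σ v) ≡ true

  -- The Boolean implication inside isHomᵇ is local to its definition, so it is only
  -- ever reached by abstracting over adj T u v, under which it computes.
  isHomᵇ-sound : ∀ T G σ → isHomᵇ T G σ ≡ true → IsHom T G σ
  isHomᵇ-sound T G σ hom u v uv
    with adj T u v | uv
       | allᵇ-true⁻ _ (allFin (n T)) (allᵇ-true⁻ _ (allFin (n T)) hom (∈-allFin u)) (∈-allFin v)
  ... | true | refl | edge = edge

  isHomᵇ-complete : ∀ T G σ → IsHom T G σ → isHomᵇ T G σ ≡ true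
  isHomᵇ-complete T G σ H with isHomᵇ T G σ in hom
  ... | true  = refl
  ... | false with allᵇ-false⁻ _ (allFin (n T)) hom
  ... | u , fromᵤ with allᵇ-false⁻ _ (allFin (n T)) fromᵤ
  ... | v , uv with adj T u v | H u v | uv
  ... | true | edge | noEdge = contradiction (trans (sym (edge refl)) noEdge) λ ()

  IsHom-≗ : ∀ T G {σ σ′} → σ ≗ σ′ → IsHom T G σ → IsHom T G σ′
  IsHom-≗ T G σ≗σ′ H u v uv = subst₂ (λ x y → adj G x y ≡ true) (σ≗σ′ u) (σ≗σ′ v) (H u v uv)

  isHomᵇ-cong : ∀ T G {σ σ′} → σ ≗ σ′ → isHomᵇ T G σ ≡ isHomᵇ T G σ′
  isHomᵇ-cong T G σ≗σ′ = ⇔→≡ {z = true} (mk⇔ (transport σ≗σ′) (transport (sym ∘ σ≗σ′)))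
    where
    transport : ∀ {τ τ′} → τ ≗ τ′ → isHomᵇ T G τ ≡ true → isHomᵇ T G τ′ ≡ true
    transport τ≗τ′ = isHomᵇ-complete T G _ ∘ IsHom-≗ T G τ≗τ′ ∘ isHomᵇ-sound T G _

  module _ {n₁ n₂ : ℕ} (R : Fin n₁ → Fin n₂ → Bool) where
    private
      G : Graph
      G = bipartite n₁ n₂ R
      V : List (Fin (n₁ + n₂))
      V = allFin (n₁ + n₂)

    adj-↑ˡ-↑ˡ : ∀ i i′ → adj G (i ↑ˡ n₂) (i′ ↑ˡ n₂) ≡ false
    adj-↑ˡ-↑ˡ i i′ rewrite splitAt-↑ˡ n₁ i n₂ | splitAt-↑ˡ n₁ i′ n₂ = refl

    adj-↑ˡ-↑ʳ : ∀ i j → adj G (i ↑ˡ n₂) (n₁ ↑ʳ j) ≡ R i j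
    adj-↑ˡ-↑ʳ i j rewrite splitAt-↑ˡ n₁ i n₂ | splitAt-↑ʳ n₁ n₂ j = refl

    adj-↑ʳ-↑ˡ : ∀ j i → adj G (n₁ ↑ʳ j) (i ↑ˡ n₂) ≡ R i j
    adj-↑ʳ-↑ˡ j i rewrite splitAt-↑ˡ n₁ i n₂ | splitAt-↑ʳ n₁ n₂ j = refl

    adj-↑ʳ-↑ʳ : ∀ j j′ → adj G (n₁ ↑ʳ j) (n₁ ↑ʳ j′) ≡ false
    adj-↑ʳ-↑ʳ j j′ rewrite splitAt-↑ʳ n₁ n₂ j | splitAt-↑ʳ n₁ n₂ j′ = refl

    degree : Fin n₁ → ℕ
    degree i = ∑[ j ∈ allFin n₂ ] ⟦ R i j ⟧

    bipEdges≡∑degree : bipEdges R ≡ ∑ (allFin n₁) degree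
    bipEdges≡∑degree = begin
      bipEdges R
        ≡⟨ length-filterᵇ _ (concatMap (λ i → map (i ,_) (allFin n₂)) (allFin n₁)) ⟩
      ∑[ p ∈ concatMap (λ i → map (i ,_) (allFin n₂)) (allFin n₁) ] ⟦ R (proj₁ p) (proj₂ p) ⟧
        ≡⟨ ∑-concatMap _ (allFin n₁) _ ⟩
      ∑[ i ∈ allFin n₁ ] ∑[ p ∈ map (i ,_) (allFin n₂) ] ⟦ R (proj₁ p) (proj₂ p) ⟧
        ≡⟨ ∑-cong (allFin n₁) (λ i → ∑-map (i ,_) (allFin n₂) _) ⟩
      ∑ (allFin n₁) degree ∎
      where open ≡-Reasoning

    handshake : ∑[ x ∈ V ] ∑[ y ∈ V ] ⟦ adj G x y ⟧ ≡ bipEdges R + bipEdges R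
    handshake = begin
      ∑[ x ∈ V ] ∑[ y ∈ V ] ⟦ adj G x y ⟧
        ≡⟨ ∑-allFin-+ n₁ n₂ _ ⟩
      (∑[ i ∈ allFin n₁ ] ∑[ y ∈ V ] ⟦ adj G (i ↑ˡ n₂) y ⟧)
        + (∑[ j ∈ allFin n₂ ] ∑[ y ∈ V ] ⟦ adj G (n₁ ↑ʳ j) y ⟧)
        ≡⟨ cong₂ _+_ (∑-cong (allFin n₁) fromLeft) (∑-cong (allFin n₂) fromRight) ⟩
      ∑ (allFin n₁) degree + ∑[ j ∈ allFin n₂ ] ∑[ i ∈ allFin n₁ ] ⟦ R i j ⟧
        ≡⟨ cong (∑ (allFin n₁) degree +_) (∑-comm (allFin n₁) (allFin n₂) (λ i j → ⟦ R i j ⟧)) ⟨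
      ∑ (allFin n₁) degree + ∑ (allFin n₁) degree
        ≡⟨ cong₂ _+_ bipEdges≡∑degree bipEdges≡∑degree ⟨
      bipEdges R + bipEdges R ∎
      where
      open ≡-Reasoning
      fromLeft : ∀ i → ∑[ y ∈ V ] ⟦ adj G (i ↑ˡ n₂) y ⟧ ≡ degree i
      fromLeft i = trans (∑-allFin-+ n₁ n₂ _)
        (cong₂ _+_ (trans (∑-cong (allFin n₁) (cong ⟦_⟧ ∘ adj-↑ˡ-↑ˡ i)) (∑-zero (allFin n₁)))
                   (∑-cong (allFin n₂) (cong ⟦_⟧ ∘ adj-↑ˡ-↑ʳ i)))
      fromRight : ∀ j → ∑[ y ∈ V ] ⟦ adj G (n₁ ↑ʳ j) y ⟧ ≡ ∑[ i ∈ allFin n₁ ] ⟦ R i j ⟧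
      fromRight j = trans (∑-allFin-+ n₁ n₂ _)
        (trans (cong₂ _+_ (∑-cong (allFin n₁) (cong ⟦_⟧ ∘ adj-↑ʳ-↑ˡ j))
                          (trans (∑-cong (allFin n₂) (cong ⟦_⟧ ∘ adj-↑ʳ-↑ʳ j)) (∑-zero (allFin n₂))))
               (+-identityʳ _))

  K-edge : ∀ s i j → adj (K s) (i ↑ˡ s) (s ↑ʳ j) ≡ true
  K-edge s = adj-↑ˡ-↑ʳ (λ _ _ → true)

  module _ {n₁ n₂ : ℕ} (R : Fin n₁ → Fin n₂ → Bool) (s : ℕ) where
    private
      G : Graph
      G = bipartite n₁ n₂ R
      V : List (Fin (n₁ + n₂))
      V = allFin (n₁ + n₂)

    hom-K≡∑∑ : hom (K s) G ≡ ∑[ f ∈ allFuns V s ] ∑[ g ∈ allFuns V s ] ⟦ isHomᵇ (K s) G (f ++ g) ⟧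
    hom-K≡∑∑ = trans (length-filterᵇ _ (allFuns V (s + s)))
                     (∑-allFuns-++ V s s _ (cong ⟦_⟧ ∘ isHomᵇ-cong (K s) G))

    hom-K-upper : hom (K s) G ≤ (bipEdges R + bipEdges R) ^ s
    hom-K-upper = begin
      hom (K s) G
        ≡⟨ hom-K≡∑∑ ⟩
      ∑[ f ∈ allFuns V s ] ∑[ g ∈ allFuns V s ] ⟦ isHomᵇ (K s) G (f ++ g) ⟧
        ≤⟨ ∑-mono-≤ (allFuns V s) (λ f → ∑-mono-≤ (allFuns V s) (λ g →
             ⟦⟧-≤ (isHomᵇ (K s) G (f ++ g)) (∏-pos s ∘ matched-edges f g))) ⟩
      ∑[ f ∈ allFuns V s ] ∑[ g ∈ allFuns V s ] ∏[ i < s ] ⟦ adj G (f i) (g i) ⟧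
        ≡⟨ ∑-allFuns²-∏ V s (λ x y → ⟦ adj G x y ⟧) ⟩
      (∑[ x ∈ V ] ∑[ y ∈ V ] ⟦ adj G x y ⟧) ^ s
        ≡⟨ cong (_^ s) (handshake R) ⟩
      (bipEdges R + bipEdges R) ^ s ∎
      where
      open ≤-Reasoning
      matched-edges : ∀ f g → isHomᵇ (K s) G (f ++ g) ≡ true → ∀ i → 0 < ⟦ adj G (f i) (g i) ⟧
      matched-edges f g hom i = ⟦⟧-pos (subst₂ (λ x y → adj G x y ≡ true) (lookup-++ˡ f g i) (lookup-++ʳ f g i)
        (isHomᵇ-sound (K s) G (f ++ g) hom (i ↑ˡ s) (s ↑ʳ i) (K-edge s i i)))

    commonNeighbours : (Fin s → Fin n₂) → ℕ
    commonNeighbours b = ∑[ x ∈ allFin n₁ ] ∏[ j < s ] ⟦ R x (b j) ⟧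

    ∑-commonNeighbours : ∑ (allFuns (allFin n₂) s) commonNeighbours ≡ ∑[ x ∈ allFin n₁ ] (degree R x ^ s)
    ∑-commonNeighbours = trans (∑-comm (allFuns (allFin n₂) s) (allFin n₁) _)
      (∑-cong (allFin n₁) (λ x → ∑-allFuns-∏ (allFin n₂) s (⟦_⟧ ∘ R x)))

    biclique⇒IsHom : (a : Fin s → Fin n₁) (b : Fin s → Fin n₂) → (∀ i j → R (a i) (b j) ≡ true) →
      IsHom (K s) G ((λ i → a i ↑ˡ n₂) ++ (λ j → n₁ ↑ʳ b j))
    biclique⇒IsHom a b complete u v uv with splitAt s u | splitAt s v | uv
    ... | inj₁ i | inj₂ j | _ = trans (adj-↑ˡ-↑ʳ R (a i) (b j)) (complete i j)
    ... | inj₂ j | inj₁ i | _ = trans (adj-↑ʳ-↑ˡ R (b j) (a i)) (complete i j)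

    ∑-commonNeighbours^-≤-hom : ∑[ b ∈ allFuns (allFin n₂) s ] (commonNeighbours b ^ s) ≤ hom (K s) G
    ∑-commonNeighbours^-≤-hom = begin
      ∑[ b ∈ Bs ] (commonNeighbours b ^ s)
        ≡⟨ ∑-cong Bs (λ b → ∑-allFuns-∏ (allFin n₁) s _) ⟨
      ∑[ b ∈ Bs ] ∑[ a ∈ As ] ∏[ i < s ] ∏[ j < s ] ⟦ R (a i) (b j) ⟧
        ≡⟨ ∑-comm As Bs _ ⟨
      ∑[ a ∈ As ] ∑[ b ∈ Bs ] ∏[ i < s ] ∏[ j < s ] ⟦ R (a i) (b j) ⟧
        ≤⟨ ∑-mono-≤ As (λ a → ∑-mono-≤ Bs (biclique-≤ a)) ⟩
      ∑[ a ∈ As ] ∑[ b ∈ Bs ] ⟦ isHomᵇ (K s) G (ι₁ ∘ a ++ ι₂ ∘ b) ⟧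
        ≤⟨ ∑-mono-≤ As (λ a → ∑-allFuns-∘-≤ V (allFin n₂) ι₂ (right-≤ ∘ ∑-allFin-+ n₁ n₂) s _
             (λ g≗g′ → cong ⟦_⟧ (isHomᵇ-cong (K s) G (++-cong (ι₁ ∘ a) (ι₁ ∘ a) (λ _ → refl) g≗g′)))) ⟩
      ∑[ a ∈ As ] ∑[ g ∈ allFuns V s ] ⟦ isHomᵇ (K s) G (ι₁ ∘ a ++ g) ⟧
        ≤⟨ ∑-allFuns-∘-≤ V (allFin n₁) ι₁ (left-≤ ∘ ∑-allFin-+ n₁ n₂) s _
             (λ f≗f′ → ∑-cong (allFuns V s) (λ g → cong ⟦_⟧ (isHomᵇ-cong (K s) G (++-cong _ _ f≗f′ (λ _ → refl))))) ⟩
      ∑[ f ∈ allFuns V s ] ∑[ g ∈ allFuns V s ] ⟦ isHomᵇ (K s) G (f ++ g) ⟧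
        ≡⟨ hom-K≡∑∑ ⟨
      hom (K s) G ∎
      where
      open ≤-Reasoning
      As = allFuns (allFin n₁) s
      Bs = allFuns (allFin n₂) s
      ι₁ : Fin n₁ → Fin (n₁ + n₂)
      ι₁ = _↑ˡ n₂
      ι₂ : Fin n₂ → Fin (n₁ + n₂)
      ι₂ = n₁ ↑ʳ_
      left-≤ : ∀ {x y z} → z ≡ x + y → x ≤ z
      left-≤ {x} {y} refl = m≤m+n x y
      right-≤ : ∀ {x y z} → z ≡ x + y → y ≤ z
      right-≤ {x} {y} refl = m≤n+m y x
      biclique-≤ : ∀ a b → ∏[ i < s ] ∏[ j < s ] ⟦ R (a i) (b j) ⟧ ≤ ⟦ isHomᵇ (K s) G (ι₁ ∘ a ++ ι₂ ∘ b) ⟧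
      biclique-≤ a b = ≤-⟦⟧ _ (∏-≤1 s (λ i → ∏-≤1 s (λ j → ⟦⟧≤1 _))) λ pos →
        isHomᵇ-complete (K s) G _ (biclique⇒IsHom a b (λ i j → ⟦⟧-pos⁻ (∏-pos⁻ s (∏-pos⁻ s pos i) j)))

  ^-distribʳ-* : ∀ a b k → (a * b) ^ k ≡ a ^ k * b ^ k
  ^-distribʳ-* a b zero    = refl
  ^-distribʳ-* a b (suc k) = trans (cong (a * b *_) (^-distribʳ-* a b k)) (interchange a b (a ^ k) (b ^ k))
    where
    interchange : ∀ a b c d → a * b * (c * d) ≡ a * c * (b * d)
    interchange = solve-∀

  power-mean-chain : ∀ t {e p q T N} → e ^ suc t ≤ p ^ t * T → T ^ suc t ≤ (q ^ suc t) ^ t * N →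
    e ^ (suc t * suc t) * (p * q) ^ suc t ≤ N * (p * q) ^ (suc t * suc t)
  power-mean-chain t {e} {p} {q} {T} {N} e≤ T≤ = begin
    e ^ (s * s) * M                    ≡⟨ cong (_* M) (^-*-assoc e s s) ⟨
    (e ^ s) ^ s * M                    ≤⟨ *-monoˡ-≤ M (^-monoˡ-≤ s e≤) ⟩
    (p ^ t * T) ^ s * M                ≡⟨ cong (_* M) (^-distribʳ-* (p ^ t) T s) ⟩
    (p ^ t) ^ s * T ^ s * M            ≤⟨ *-monoˡ-≤ M (*-monoʳ-≤ ((p ^ t) ^ s) T≤) ⟩
    (p ^ t) ^ s * ((q ^ s) ^ t * N) * M ≡⟨ regroup ((p ^ t) ^ s) ((q ^ s) ^ t) N M ⟩
    N * ((p ^ t) ^ s * (q ^ s) ^ t * M) ≡⟨ cong (λ z → N * (z * M)) pq^ts ⟩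
    N * ((p * q) ^ (t * s) * M)        ≡⟨ cong (N *_) (^-distribˡ-+-* (p * q) (t * s) s) ⟨
    N * (p * q) ^ (t * s + s)          ≡⟨ cong (λ z → N * (p * q) ^ z) (+-comm (t * s) s) ⟩
    N * (p * q) ^ (s * s)              ∎
    where
    open ≤-Reasoning
    s = suc t
    M = (p * q) ^ s
    regroup : ∀ a b c d → a * (b * c) * d ≡ c * (a * b * d)
    regroup = solve-∀
    pq^ts : (p ^ t) ^ s * (q ^ s) ^ t ≡ (p * q) ^ (t * s)
    pq^ts = begin-equality
      (p ^ t) ^ s * (q ^ s) ^ t  ≡⟨ cong₂ _*_ (^-*-assoc p t s) (trans (^-*-assoc q s t) (cong (q ^_) (*-comm s t))) ⟩
      p ^ (t * s) * q ^ (t * s)  ≡⟨ ^-distribʳ-* p q (t * s) ⟨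
      (p * q) ^ (t * s)          ∎

  hom-K-lower : ∀ {n₁ n₂} (R : Fin n₁ → Fin n₂ → Bool) t →
    bipEdges R ^ (suc t * suc t) * (n₁ * n₂) ^ suc t
      ≤ hom (K (suc t)) (bipartite n₁ n₂ R) * (n₁ * n₂) ^ (suc t * suc t)
  hom-K-lower {n₁} {n₂} R t = power-mean-chain t {bipEdges R} {n₁} {n₂} edges≤ degrees≤
    where
    open ≤-Reasoning
    s = suc t
    Bs = allFuns (allFin n₂) s
    length-allFin : ∀ m → length (allFin m) ≡ m
    length-allFin m = length-tabulate id
    edges≤ : bipEdges R ^ s ≤ n₁ ^ t * ∑[ x ∈ allFin n₁ ] (degree R x ^ s)
    edges≤ = begin
      bipEdges R ^ s
        ≡⟨ cong (_^ s) (bipEdges≡∑degree R) ⟩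
      ∑ (allFin n₁) (degree R) ^ s
        ≤⟨ power-mean (allFin n₁) (degree R) t ⟩
      length (allFin n₁) ^ t * ∑[ x ∈ allFin n₁ ] (degree R x ^ s)
        ≡⟨ cong (λ m → m ^ t * ∑[ x ∈ allFin n₁ ] (degree R x ^ s)) (length-allFin n₁) ⟩
      n₁ ^ t * ∑[ x ∈ allFin n₁ ] (degree R x ^ s) ∎
    degrees≤ : (∑[ x ∈ allFin n₁ ] (degree R x ^ s)) ^ s ≤ (n₂ ^ s) ^ t * hom (K s) (bipartite n₁ n₂ R)
    degrees≤ = begin
      (∑[ x ∈ allFin n₁ ] (degree R x ^ s)) ^ s
        ≡⟨ cong (_^ s) (∑-commonNeighbours R s) ⟨
      ∑ Bs (commonNeighbours R s) ^ s
        ≤⟨ power-mean Bs (commonNeighbours R s) t ⟩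
      length Bs ^ t * ∑[ b ∈ Bs ] (commonNeighbours R s b ^ s)
        ≡⟨ cong (λ m → m ^ t * ∑[ b ∈ Bs ] (commonNeighbours R s b ^ s))
                (trans (length-allFuns (allFin n₂) s) (cong (_^ s) (length-allFin n₂))) ⟩
      (n₂ ^ s) ^ t * ∑[ b ∈ Bs ] (commonNeighbours R s b ^ s)
        ≤⟨ *-monoʳ-≤ ((n₂ ^ s) ^ t) (∑-commonNeighbours^-≤-hom R s) ⟩
      (n₂ ^ s) ^ t * hom (K s) (bipartite n₁ n₂ R) ∎

open import Data.Bool using (Bool)
open import Data.Nat using (ℕ; zero; suc; _+_; _*_; _^_; NonZero; z≤n)
import Data.Nat as ℕ
open import Data.Nat.Properties using (m^n≢0; +-identityʳ)
open import Data.Nat.Coprimality using (1-coprimeTo)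
import Data.Nat.Coprimality as Coprimality
open import Data.Fin using (Fin)
open import Data.Product using (_×_; _,_)
open import Data.Integer using (+_)
import Data.Integer as ℤ
import Data.Integer.Properties as ℤ
open import Data.Rational using (ℚ; mkℚ; _/_; 0ℚ; 1ℚ; _<_; _≤_; *≤*; Positive) renaming (_*_ to _*ℚ_)
open import Data.Rational.Properties
  using (normalize-coprime; *-assoc; *-zeroʳ; *-1-commutativeMonoid; ≤-trans; ≤-reflexive; *-cancelʳ-≤-pos; module ≤-Reasoning)
open import Algebra.Bundles using (CommutativeMonoid)
open import Algebra.Properties.CommutativeSemigroup (CommutativeMonoid.commutativeSemigroup *-1-commutativeMonoid)
  using (interchange; xy∙z≈xz∙y)
open import Relation.Binary.PropositionalEquality
open Counting using (hom-K-upper; hom-K-lower)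

ℕ→ℚ≡mkℚ : ∀ m → ℕ→ℚ m ≡ mkℚ (+ m) 0 (Coprimality.sym (1-coprimeTo m))
ℕ→ℚ≡mkℚ m = normalize-coprime (Coprimality.sym (1-coprimeTo m))

ℕ→ℚ-* : ∀ a b → ℕ→ℚ (a * b) ≡ ℕ→ℚ a *ℚ ℕ→ℚ b
ℕ→ℚ-* a b rewrite ℕ→ℚ≡mkℚ a | ℕ→ℚ≡mkℚ b = cong (_/ 1) (ℤ.pos-* a b)

ℕ→ℚ-^ : ∀ a k → ℕ→ℚ (a ^ k) ≡ ℕ→ℚ a ^ℚ k
ℕ→ℚ-^ a zero    = refl
ℕ→ℚ-^ a (suc k) = trans (ℕ→ℚ-* a (a ^ k)) (cong (ℕ→ℚ a *ℚ_) (ℕ→ℚ-^ a k))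

ℕ→ℚ-mono-≤ : ∀ {a b} → a ℕ.≤ b → ℕ→ℚ a ≤ ℕ→ℚ b
ℕ→ℚ-mono-≤ {a} {b} a≤b rewrite ℕ→ℚ≡mkℚ a | ℕ→ℚ≡mkℚ b =
  *≤* (subst₂ ℤ._≤_ (sym (ℤ.*-identityʳ (+ a))) (sym (ℤ.*-identityʳ (+ b))) (ℤ.+≤+ a≤b))

ℕ→ℚ-pos : ∀ m .{{_ : NonZero m}} → Positive (ℕ→ℚ m)
ℕ→ℚ-pos (suc m) rewrite ℕ→ℚ≡mkℚ (suc m) = _

^ℚ-distrib-* : ∀ x y k → (x *ℚ y) ^ℚ k ≡ x ^ℚ k *ℚ y ^ℚ k
^ℚ-distrib-* x y zero    = refl
^ℚ-distrib-* x y (suc k) = trans (cong (x *ℚ y *ℚ_) (^ℚ-distrib-* x y k)) (interchange x y (x ^ℚ k) (y ^ℚ k))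

density-^ : ∀ α m e k → ℕ→ℚ e ≡ α *ℚ ℕ→ℚ m → ℕ→ℚ (e ^ k) ≡ α ^ℚ k *ℚ ℕ→ℚ (m ^ k)
density-^ α m e k e≡αm = begin
  ℕ→ℚ (e ^ k)                 ≡⟨ ℕ→ℚ-^ e k ⟩
  ℕ→ℚ e ^ℚ k                  ≡⟨ cong (_^ℚ k) e≡αm ⟩
  (α *ℚ ℕ→ℚ m) ^ℚ k           ≡⟨ ^ℚ-distrib-* α (ℕ→ℚ m) k ⟩
  α ^ℚ k *ℚ ℕ→ℚ m ^ℚ k        ≡⟨ cong (α ^ℚ k *ℚ_) (ℕ→ℚ-^ m k) ⟨
  α ^ℚ k *ℚ ℕ→ℚ (m ^ k)       ∎
  where open ≡-Reasoning

upper-ℚ : ∀ α m e h k → ℕ→ℚ e ≡ α *ℚ ℕ→ℚ m → h ℕ.≤ (e + e) ^ k →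
  ℕ→ℚ h ≤ ((ℕ→ℚ 2 *ℚ α) ^ℚ k) *ℚ ℕ→ℚ (m ^ k)
upper-ℚ α m e h k e≡αm h≤ = ≤-trans (ℕ→ℚ-mono-≤ h≤) (≤-reflexive (density-^ (ℕ→ℚ 2 *ℚ α) m (e + e) k 2e≡2αm))
  where
  open ≡-Reasoning
  2e≡2αm : ℕ→ℚ (e + e) ≡ (ℕ→ℚ 2 *ℚ α) *ℚ ℕ→ℚ m
  2e≡2αm = begin
    ℕ→ℚ (e + e)               ≡⟨ cong (λ z → ℕ→ℚ (e + z)) (+-identityʳ e) ⟨
    ℕ→ℚ (2 * e)               ≡⟨ ℕ→ℚ-* 2 e ⟩
    ℕ→ℚ 2 *ℚ ℕ→ℚ e            ≡⟨ cong (ℕ→ℚ 2 *ℚ_) e≡αm ⟩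
    ℕ→ℚ 2 *ℚ (α *ℚ ℕ→ℚ m)     ≡⟨ *-assoc (ℕ→ℚ 2) α (ℕ→ℚ m) ⟨
    (ℕ→ℚ 2 *ℚ α) *ℚ ℕ→ℚ m     ∎

lower-ℚ : ∀ α m e h t → ℕ→ℚ e ≡ α *ℚ ℕ→ℚ m →
  e ^ (suc t * suc t) * m ^ suc t ℕ.≤ h * m ^ (suc t * suc t) →
  (α ^ℚ (suc t * suc t)) *ℚ ℕ→ℚ (m ^ suc t) ≤ ℕ→ℚ h
lower-ℚ α zero      e h t _    _  = ≤-trans (≤-reflexive (*-zeroʳ (α ^ℚ (suc t * suc t)))) (ℕ→ℚ-mono-≤ {0} {h} z≤n)
lower-ℚ α m@(suc _) e h t e≡αm le = *-cancelʳ-≤-pos (ℕ→ℚ (m ^ ss)) {{ℕ→ℚ-pos (m ^ ss) {{m^n≢0 m ss}}}} (begin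
  α ^ℚ ss *ℚ ℕ→ℚ (m ^ s) *ℚ ℕ→ℚ (m ^ ss)      ≡⟨ xy∙z≈xz∙y (α ^ℚ ss) _ _ ⟩
  α ^ℚ ss *ℚ ℕ→ℚ (m ^ ss) *ℚ ℕ→ℚ (m ^ s)      ≡⟨ cong (_*ℚ ℕ→ℚ (m ^ s)) (density-^ α m e ss e≡αm) ⟨
  ℕ→ℚ (e ^ ss) *ℚ ℕ→ℚ (m ^ s)                 ≡⟨ ℕ→ℚ-* (e ^ ss) (m ^ s) ⟨
  ℕ→ℚ (e ^ ss * m ^ s)                        ≤⟨ ℕ→ℚ-mono-≤ le ⟩
  ℕ→ℚ (h * m ^ ss)                            ≡⟨ ℕ→ℚ-* h (m ^ ss) ⟩
  ℕ→ℚ h *ℚ ℕ→ℚ (m ^ ss)                       ∎)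
  where
  open ≤-Reasoning
  s = suc t
  ss = s * s

corollary3 : (n₁ n₂ : ℕ) (R : Fin n₁ → Fin n₂ → Bool) (α : ℚ) →
    NoIsolated (bipartite n₁ n₂ R) →
    0ℚ < α → α ≤ 1ℚ →
    ℕ→ℚ (bipEdges R) ≡ α *ℚ ℕ→ℚ (n₁ * n₂) →
    (s : ℕ) → .{{_ : NonZero s}} →
    (α ^ℚ (s * s)) *ℚ ℕ→ℚ ((n₁ * n₂) ^ s) ≤ ℕ→ℚ (hom (K s) (bipartite n₁ n₂ R))
    × ℕ→ℚ (hom (K s) (bipartite n₁ n₂ R)) ≤ ((ℕ→ℚ 2 *ℚ α) ^ℚ s) *ℚ ℕ→ℚ ((n₁ * n₂) ^ s)
corollary3 n₁ n₂ R α _ _ _ edges (suc t) =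
  lower-ℚ α (n₁ * n₂) (bipEdges R) homs t edges (hom-K-lower R t) ,
  upper-ℚ α (n₁ * n₂) (bipEdges R) homs (suc t) edges (hom-K-upper R (suc t))
  where
  homs = hom (K (suc t)) (bipartite n₁ n₂ R)
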